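{- Let $C$ and $F$ be column-Latin squares of order $n$. Then $(C,F)$ is a transversal representation pair if and only if there is a Latin square $Z$ of order $n$ such that $CZ=F$. Moreover, if $C$ is a Latin square, then $Z$ is orthogonal to $F$.
   Context: A column-Latin square of order $n$ is an $n\times n$ array on symbols $\{0,\dots,n-1\}$ (rows, columns indexed $0,\dots,n-1$) in which every column is a permutation of $\{0,\dots,n-1\}$; a Latin square is a column-Latin square whose rows are also permutations. The composition of column-Latin squares $F,G$ is $FG$ with $(FG)[i,j]=F[G[i,j],j]$. Column-Latin squares $A,B$ are orthogonal if for all $i,i',j,j'$: $A[i,j]=A[i',j']$ and $B[i,j]=B[i',j']$ imply $j=j'$. $(A,B)$ is a transversal representation pair (TRP) if for all $i,i',j,j'$: $A[i,j]=B[i',j]$ and $A[i,j']=B[i',j']$ imply $j=j'$. -}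

module Defs where

open import Data.Nat using (ℕ)
open import Data.Fin using (Fin)
open import Data.Product using (_×_)
open import Relation.Binary.PropositionalEquality using (_≡_)
open import Function.Definitions using (Bijective)

-- A square of order n: entry A i j in row i, column j.
Square : ℕ → Set
Square n = Fin n → Fin n → Fin n

IsColumnLatin : ∀ {n} → Square n → Set
IsColumnLatin {n} A = ∀ (j : Fin n) → Bijective _≡_ _≡_ (λ i → A i j)

IsLatin : ∀ {n} → Square n → Set
IsLatin {n} A = IsColumnLatin A × (∀ (i : Fin n) → Bijective _≡_ _≡_ (λ j → A i j))

compose : ∀ {n} → Square n → Square n → Square n
compose F G i j = F (G i j) j

Orthogonal : ∀ {n} → Square n → Square n → Set
Orthogonal {n} A B = ∀ (i i' j j' : Fin n) →
  A i j ≡ A i' j' → B i j ≡ B i' j' → j ≡ j'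

IsTRP : ∀ {n} → Square n → Square n → Set
IsTRP {n} A B = ∀ (i i' j j' : Fin n) →
  A i j ≡ B i' j → A i j' ≡ B i' j' → j ≡ j'

{-# OPTIONS --safe #-}
-- Since every column of C is a permutation, CZ = F forces Z = C⁻¹F, where C⁻¹
-- inverts C column by column; this Z is column-Latin for free. Given CZ = F, the
-- TRP condition on (C, F) says precisely that the rows of Z are injective, and an
-- injective endomap of Fin n is a permutation. For orthogonality only the rows
-- of C matter: if Z i j = Z i' j' = k and F i j = F i' j', then C k j = C k j'.
module Submission where

open import Defs
open import Data.Empty using (⊥-elim)
open import Data.Nat using (ℕ; zero; suc)
open import Data.Nat.Properties using (n<1+n)
open import Data.Fin using (Fin; punchOut)
open import Data.Fin.Properties using (any?; _≟_; punchOut-injective; <⇒notInjective)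
open import Data.Product using (_×_; Σ; _,_; proj₁; proj₂)
open import Function.Definitions using (Bijective; Injective; Surjective)
import Function.Construct.Composition as Composition
import Function.Construct.Symmetry as Symmetry
open import Relation.Binary.PropositionalEquality using (_≡_; _≢_; refl; sym; trans; cong; module ≡-Reasoning)
open import Relation.Nullary using (yes; no)

private
  variable
    n : ℕ

injective⇒surjective : {f : Fin n → Fin n} → Injective _≡_ _≡_ f → Surjective _≡_ _≡_ f
injective⇒surjective {zero}  _ ()
injective⇒surjective {suc m} {f} f-inj y with any? (λ x → f x ≟ y)
... | yes (x , fx≡y) = x , λ { refl → fx≡y }
... | no ∄x = ⊥-elim (<⇒notInjective (n<1+n m) punchOut∘f-injective)
  where
  y≢f : ∀ x → y ≢ f x
  y≢f x y≡fx = ∄x (x , sym y≡fx)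

  punchOut∘f-injective : Injective _≡_ _≡_ (λ x → punchOut (y≢f x))
  punchOut∘f-injective eq = f-inj (punchOut-injective (y≢f _) (y≢f _) eq)

injective⇒bijective : {f : Fin n → Fin n} → Injective _≡_ _≡_ f → Bijective _≡_ _≡_ f
injective⇒bijective f-inj = f-inj , injective⇒surjective f-inj

RowInjective : Square n → Set
RowInjective {n} A = ∀ (i : Fin n) → Injective _≡_ _≡_ (A i)

columnLatin∧rowInjective⇒isLatin : {A : Square n} → IsColumnLatin A → RowInjective A → IsLatin A
columnLatin∧rowInjective⇒isLatin cA rA = cA , λ i → injective⇒bijective (rA i)

compose-isColumnLatin : {F G : Square n} → IsColumnLatin F → IsColumnLatin G →
  IsColumnLatin (compose F G)
compose-isColumnLatin cF cG j = Composition.bijective _≡_ _≡_ _≡_ (cG j) (cF j)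

columnInverse : (C : Square n) → IsColumnLatin C → Square n
columnInverse C cC i j = proj₁ (proj₂ (cC j) i)

columnInverse-isColumnLatin : {C : Square n} (cC : IsColumnLatin C) →
  IsColumnLatin (columnInverse C cC)
columnInverse-isColumnLatin cC j = Symmetry.bijective (cC j) refl sym trans (cong _)

compose-columnInverse : {C : Square n} (cC : IsColumnLatin C) →
  ∀ i j → compose C (columnInverse C cC) i j ≡ i
compose-columnInverse cC i j = proj₂ (proj₂ (cC j) i) refl

module _ {C Z F : Square n} (CZ≡F : ∀ i j → compose C Z i j ≡ F i j) where

  isTRP⇒rowInjective : IsTRP C F → RowInjective Z
  isTRP⇒rowInjective trp i {j} {j'} Zij≡Zij' =
    trp (Z i j) i j j' (CZ≡F i j) (trans (cong (λ k → C k j') Zij≡Zij') (CZ≡F i j'))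

  rowInjective⇒isTRP : IsColumnLatin C → RowInjective Z → IsTRP C F
  rowInjective⇒isTRP cC rZ i i' j j' Cij≡Fi'j Cij'≡Fi'j' =
    rZ i' (trans (sym (row-of j Cij≡Fi'j)) (row-of j' Cij'≡Fi'j'))
    where
    row-of : ∀ l → C i l ≡ F i' l → i ≡ Z i' l
    row-of l Cil≡Fi'l = proj₁ (cC l) (trans Cil≡Fi'l (sym (CZ≡F i' l)))

  rowInjective⇒orthogonal : RowInjective C → Orthogonal Z F
  rowInjective⇒orthogonal rC i i' j j' Zij≡Zi'j' Fij≡Fi'j' = rC (Z i j) (begin
    C (Z i j) j     ≡⟨ CZ≡F i j ⟩
    F i j           ≡⟨ Fij≡Fi'j' ⟩
    F i' j'         ≡⟨ sym (CZ≡F i' j') ⟩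
    C (Z i' j') j'  ≡⟨ cong (λ k → C k j') (sym Zij≡Zi'j') ⟩
    C (Z i j) j'    ∎)
    where open ≡-Reasoning

LatinFactorisation : Square n → Square n → Set
LatinFactorisation {n} C F = Σ (Square n) (λ Z → IsLatin Z × (∀ i j → compose C Z i j ≡ F i j))

isTRP⇒latinFactorisation : {C F : Square n} → IsColumnLatin C → IsColumnLatin F →
  IsTRP C F → LatinFactorisation C F
isTRP⇒latinFactorisation {C = C} {F} cC cF trp =
  Z , columnLatin∧rowInjective⇒isLatin Z-isColumnLatin (isTRP⇒rowInjective CZ≡F trp) , CZ≡F
  where
  Z : Square _
  Z = compose (columnInverse C cC) F

  Z-isColumnLatin : IsColumnLatin Z
  Z-isColumnLatin = compose-isColumnLatin (columnInverse-isColumnLatin cC) cF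

  CZ≡F : ∀ i j → compose C Z i j ≡ F i j
  CZ≡F i j = compose-columnInverse cC (F i j) j

latinFactorisation⇒isTRP : {C F : Square n} → IsColumnLatin C → LatinFactorisation C F → IsTRP C F
latinFactorisation⇒isTRP cC (Z , (_ , rZ) , CZ≡F) = rowInjective⇒isTRP CZ≡F cC (λ i → proj₁ (rZ i))

proposition2 : ∀ (n : ℕ) (C F : Square n) →
    IsColumnLatin C → IsColumnLatin F →
    (IsTRP C F → Σ (Square n) (λ Z → IsLatin Z × ((∀ i j → compose C Z i j ≡ F i j))))
    × (Σ (Square n) (λ Z → IsLatin Z × ((∀ i j → compose C Z i j ≡ F i j))) → IsTRP C F)
    × (IsLatin C → ∀ (Z : Square n) → IsLatin Z → (∀ i j → compose C Z i j ≡ F i j) → Orthogonal Z F)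
proposition2 n C F cC cF =
  isTRP⇒latinFactorisation cC cF ,
  latinFactorisation⇒isTRP cC ,
  λ (_ , rC) Z _ CZ≡F → rowInjective⇒orthogonal CZ≡F (λ k → proj₁ (rC k))
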